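{- Let $l,m,k$ be non-negative integers such that $2l \leq m \leq 2k$. Then $$ \mathcal{S}(k,m,l)=\sum_{d=0}^{k+l-m}\left[\binom{m}{l}-\binom{m}{l-d-1}\right]\left[\binom{2k-m+1}{k-m+l-d}-\binom{2k-m+1}{k-m+l-d-1}\right], $$ where $\mathcal{S}(k,m,l)$ denotes the total number, summed over all Dyck paths of semilength $k$, of intervals of length $m$ containing exactly $l$ falls.
   Context: A Dyck path of semilength $k$ is a lattice path in $\mathbb{Z}^2$ from $(0,0)$ to $(2k,0)$ that never goes below the $x$-axis and each of whose steps is either $(1,1)$ (a rise) or $(1,-1)$ (a fall). For such a path $D$ and non-negative integers $l\le m\le 2k$, let $\mathcal{S}(D,m,l)$ be the number of intervals of length $m$ in $D$ (i.e. sequences of $m$ consecutive steps of $D$) that contain exactly $l$ falls, and let $\mathcal{S}(k,m,l)=\sum_D \mathcal{S}(D,m,l)$, the sum over all Dyck paths $D$ of semilength $k$. Binomial coefficients follow the convention $\binom{x}{y}=0$ for integers $x\ge 0$ and $y<0$ (and, as usual, $\binom{x}{y}=0$ when $y>x\ge 0$). -}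

module Defs where

open import Data.Bool using (Bool; true; false; not; if_then_else_)
open import Data.Nat using (ℕ; zero; suc; _+_; _∸_; _≡ᵇ_)
open import Data.Nat.Combinatorics using (_C_)
open import Data.List using (List; []; _∷_; length; filter; take; drop; map; concatMap; upTo)
open import Data.Nat.ListAction using (sum)
open import Data.Integer as ℤ using (ℤ; +_; -[1+_])

-- A step: true = rise (1,1), false = fall (1,-1).
Step : Set
Step = Bool

allSeqs : ℕ → List (List Step)
allSeqs zero    = [] ∷ []
allSeqs (suc n) = concatMap (λ xs → (true ∷ xs) ∷ (false ∷ xs) ∷ []) (allSeqs n)

dyckFrom : ℕ → List Step → Bool
dyckFrom h       []            = h ≡ᵇ 0
dyckFrom h       (true  ∷ xs)  = dyckFrom (suc h) xs
dyckFrom zero    (false ∷ xs)  = false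
dyckFrom (suc h) (false ∷ xs)  = dyckFrom h xs

isDyck : List Step → Bool
isDyck = dyckFrom 0

dyckPaths : ℕ → List (List Step)
dyckPaths k = filter (λ xs → isDyck xs Data.Bool.≟ true) (allSeqs (k + k))
  where import Data.Bool

falls : List Step → ℕ
falls xs = length (filter (λ b → not b Data.Bool.≟ true) xs)
  where import Data.Bool

SD : List Step → ℕ → ℕ → ℕ
SD D m l =
  length (filter (λ i → falls (take m (drop i D)) Data.Nat.≟ l)
                 (upTo (suc (length D) ∸ m)))
  where import Data.Nat

S : ℕ → ℕ → ℕ → ℕ
S k m l = sum (map (λ D → SD D m l) (dyckPaths k))

binomℤ : ℕ → ℤ → ℤ
binomℤ n (+ j)     = + (n C j)
binomℤ n -[1+ _ ]  = + 0

sumℤ : ℕ → (ℕ → ℤ) → ℤ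
sumℤ zero    f = + 0
sumℤ (suc n) f = sumℤ n f ℤ.+ f n

-- Right-hand side: Σ_{d=0}^{k+l-m} [C(m,l) - C(m,l-d-1)] [C(2k-m+1,k-m+l-d) - C(2k-m+1,k-m+l-d-1)]
-- (the sum is empty when k+l-m < 0; number of terms is (k+l+1) ∸ m).
RHS : ℕ → ℕ → ℕ → ℤ
RHS k m l =
  sumℤ (suc (k + l) ∸ m) λ d →
    (binomℤ m (+ l) ℤ.- binomℤ m (+ l ℤ.- + d ℤ.- + 1))
    ℤ.* (binomℤ N (+ k ℤ.- + m ℤ.+ + l ℤ.- + d)
         ℤ.- binomℤ N (+ k ℤ.- + m ℤ.+ + l ℤ.- + d ℤ.- + 1))
  where N = suc ((k + k) ∸ m)

{-# OPTIONS --safe #-}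
-- Cutting a Dyck path at an interval of length m starting at position i writes it as A ++ W ++ B:
-- A is a walk from 0 to some height h, W a walk of length m from h with l falls, hence ending at
-- h + s where s = m − 2l, and B a walk of length n − i from h + s down to 0, where n = 2k − m (all
-- walks staying ≥ 0). Summed over i, the products #A · #B are the decomposition of the walks of
-- length n + 1 from 0 to 2h + s + 1 at their last visit to h, so
--   S(k,m,l) = Σ_h W(m,h,l) · walks(n + 1, 0, 2h + s + 1).
-- By the reflection principle W(m,h,l) = C(m,l) − C(m,l−h−1), and the second factor, the walks of
-- length n + 1 from 0 with f = k + l − m − h falls, is C(n+1,f) − C(n+1,f−1); it vanishes for
-- h > k + l − m.
module Submission where

open import Data.Bool using (Bool; true; false; if_then_else_)
import Data.Bool as Bool
open import Data.List using (List; []; _∷_; [_]; _++_; _∷ʳ_; length; filter; map; concatMap; take; drop; upTo)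
open import Data.List.Properties using (applyUpTo-∷ʳ; map-++)
open import Data.Maybe using (Maybe; just; nothing; maybe′; is-just)
open import Data.Nat
open import Data.Nat.Combinatorics using (_C_; nCk+nC[k+1]≡[n+1]C[k+1])
open import Data.Nat.ListAction using (sum)
open import Data.Nat.ListAction.Properties using (sum-++)
open import Data.Nat.Properties
open import Data.Nat.Tactic.RingSolver using (solve-∀)
open import Algebra.Properties.CommutativeSemigroup +-commutativeSemigroup using (interchange)
open import Algebra.Properties.CommutativeSemigroup *-commutativeSemigroup using () renaming (x∙yz≈y∙xz to m*[n*o]≡n*[m*o])
open import Data.Integer as ℤ using (ℤ; +_; _⊖_)
import Data.Integer.Properties as ℤP
open import Data.Sum using (inj₁; inj₂)
open import Function using (id; _∘_)
open import Relation.Binary.PropositionalEquality hiding ([_])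
open import Relation.Nullary using (does; yes; no; contradiction)
open import Relation.Unary using (Pred; Decidable)
open import Defs
open ≡-Reasoning

toℕ : Bool → ℕ
toℕ b = if b then 1 else 0

δ : ℕ → ℕ → ℕ
δ a b = toℕ (a ≡ᵇ b)

δ-refl : ∀ a → δ a a ≡ 1
δ-refl zero    = refl
δ-refl (suc a) = δ-refl a

δ-≢ : ∀ a b → a ≢ b → δ a b ≡ 0
δ-≢ zero    zero    a≢b = contradiction refl a≢b
δ-≢ zero    (suc b) _   = refl
δ-≢ (suc a) zero    _   = refl
δ-≢ (suc a) (suc b) a≢b = δ-≢ a b (a≢b ∘ cong suc)

δ-*-cong : ∀ a b {x y} → (a ≡ b → x ≡ y) → δ a b * x ≡ δ a b * y
δ-*-cong a b x≡y with a ≟ b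
... | yes a≡b = cong (δ a b *_) (x≡y a≡b)
... | no  a≢b = trans (cong (_* _) (δ-≢ a b a≢b)) (sym (cong (_* _) (δ-≢ a b a≢b)))

∑ : ℕ → (ℕ → ℕ) → ℕ
∑ zero    f = 0
∑ (suc n) f = ∑ n f + f n

infix 6.5 ∑
syntax ∑ n (λ i → e) = ∑[ i < n ] e

∑-cong : ∀ n {f g : ℕ → ℕ} → (∀ i → i < n → f i ≡ g i) → ∑ n f ≡ ∑ n g
∑-cong zero    f≗g = refl
∑-cong (suc n) f≗g = cong₂ _+_ (∑-cong n (λ i i<n → f≗g i (m<n⇒m<1+n i<n))) (f≗g n ≤-refl)

∑-0 : ∀ n → ∑[ i < n ] 0 ≡ 0
∑-0 zero    = refl
∑-0 (suc n) = trans (+-identityʳ _) (∑-0 n)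

∑-+ : ∀ n (f g : ℕ → ℕ) → ∑[ i < n ] (f i + g i) ≡ ∑ n f + ∑ n g
∑-+ zero    f g = refl
∑-+ (suc n) f g = trans (cong (_+ (f n + g n)) (∑-+ n f g)) (interchange (∑ n f) (∑ n g) (f n) (g n))

∑-*ˡ : ∀ n c (f : ℕ → ℕ) → ∑[ i < n ] (c * f i) ≡ c * ∑ n f
∑-*ˡ zero    c f = sym (*-zeroʳ c)
∑-*ˡ (suc n) c f = trans (cong (_+ c * f n) (∑-*ˡ n c f)) (sym (*-distribˡ-+ c (∑ n f) (f n)))

∑-comm : ∀ a b (g : ℕ → ℕ → ℕ) → ∑[ i < a ] ∑[ j < b ] g i j ≡ ∑[ j < b ] ∑[ i < a ] g i j
∑-comm zero    b g = sym (∑-0 b)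
∑-comm (suc a) b g = begin
  ∑[ i < a ] ∑[ j < b ] g i j + ∑[ j < b ] g a j  ≡⟨ cong (_+ ∑[ j < b ] g a j) (∑-comm a b g) ⟩
  ∑[ j < b ] ∑[ i < a ] g i j + ∑[ j < b ] g a j  ≡⟨ ∑-+ b _ _ ⟨
  ∑[ j < b ] (∑[ i < a ] g i j + g a j)           ∎

∑-truncate : ∀ {M N} (f : ℕ → ℕ) → M ≤ N → (∀ i → M ≤ i → f i ≡ 0) → ∑ N f ≡ ∑ M f
∑-truncate {M} f M≤N vanish = go (≤⇒≤′ M≤N)
  where
  go : ∀ {N} → M ≤′ N → ∑ N f ≡ ∑ M f
  go ≤′-refl        = refl
  go (≤′-step M≤′N) = trans (cong₂ _+_ (go M≤′N) (vanish _ (≤′⇒≤ M≤′N))) (+-identityʳ _)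

∑-δ : ∀ n a (g : ℕ → ℕ) → a < n → ∑[ i < n ] (δ a i * g i) ≡ g a
∑-δ (suc n) a g a<1+n with m<1+n⇒m<n∨m≡n a<1+n
... | inj₁ a<n  = trans (cong₂ _+_ (∑-δ n a g a<n) (cong (_* g n) (δ-≢ a n (<⇒≢ a<n)))) (+-identityʳ (g a))
... | inj₂ refl = cong₂ _+_
  (trans (∑-cong a (λ i i<a → cong (_* g i) (δ-≢ a i (>⇒≢ i<a)))) (∑-0 a))
  (trans (cong (_* g a) (δ-refl a)) (+-identityʳ (g a)))

module _ {A : Set} where

  sum-map-0 : ∀ (xs : List A) f → (∀ x → f x ≡ 0) → sum (map f xs) ≡ 0
  sum-map-0 []       f f≗0 = refl
  sum-map-0 (x ∷ xs) f f≗0 = cong₂ _+_ (f≗0 x) (sum-map-0 xs f f≗0)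

  sum-map-+ : ∀ (xs : List A) f g → sum (map (λ x → f x + g x) xs) ≡ sum (map f xs) + sum (map g xs)
  sum-map-+ []       f g = refl
  sum-map-+ (x ∷ xs) f g =
    trans (cong (_+_ (f x + g x)) (sum-map-+ xs f g)) (interchange (f x) (g x) _ _)

  sum-map-*ʳ : ∀ (xs : List A) f c → sum (map (λ x → f x * c) xs) ≡ sum (map f xs) * c
  sum-map-*ʳ []       f c = refl
  sum-map-*ʳ (x ∷ xs) f c =
    trans (cong (_+_ (f x * c)) (sum-map-*ʳ xs f c)) (sym (*-distribʳ-+ c (f x) _))

  sum-map-∑ : ∀ (xs : List A) n (f : ℕ → A → ℕ) →
    sum (map (λ x → ∑[ i < n ] f i x) xs) ≡ ∑[ i < n ] sum (map (f i) xs)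
  sum-map-∑ xs zero    f = sum-map-0 xs _ (λ _ → refl)
  sum-map-∑ xs (suc n) f = trans (sum-map-+ xs _ _) (cong (_+ sum (map (f n) xs)) (sum-map-∑ xs n f))

  sum-map-filter : ∀ {p} {P : Pred A p} (P? : Decidable P) (xs : List A) f →
    sum (map f (filter P? xs)) ≡ sum (map (λ x → if does (P? x) then f x else 0) xs)
  sum-map-filter P? []       f = refl
  sum-map-filter P? (x ∷ xs) f with does (P? x)
  ... | true  = cong (_+_ (f x)) (sum-map-filter P? xs f)
  ... | false = sum-map-filter P? xs f

  length-filter : ∀ {p} {P : Pred A p} (P? : Decidable P) (xs : List A) →
    length (filter P? xs) ≡ sum (map (λ x → toℕ (does (P? x))) xs)
  length-filter P? []       = refl
  length-filter P? (x ∷ xs) with does (P? x)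
  ... | true  = cong suc (length-filter P? xs)
  ... | false = length-filter P? xs

sum-map-upTo : ∀ n f → sum (map f (upTo n)) ≡ ∑ n f
sum-map-upTo zero    f = refl
sum-map-upTo (suc n) f = begin
  sum (map f (upTo (suc n)))        ≡⟨ cong (sum ∘ map f) (applyUpTo-∷ʳ id n) ⟨
  sum (map f (upTo n ∷ʳ n))         ≡⟨ cong sum (map-++ f (upTo n) [ n ]) ⟩
  sum (map f (upTo n) ++ [ f n ])   ≡⟨ sum-++ (map f (upTo n)) [ f n ] ⟩
  sum (map f (upTo n)) + (f n + 0)  ≡⟨ cong₂ _+_ (sum-map-upTo n f) (+-identityʳ (f n)) ⟩
  ∑ n f + f n                       ∎

∑seq : ℕ → (List Step → ℕ) → ℕ
∑seq n f = sum (map f (allSeqs n))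

∑seq-suc : ∀ n f → ∑seq (suc n) f ≡ ∑seq n (f ∘ (true ∷_)) + ∑seq n (f ∘ (false ∷_))
∑seq-suc n f = go (allSeqs n)
  where
  go : ∀ xss → sum (map f (concatMap (λ xs → (true ∷ xs) ∷ (false ∷ xs) ∷ []) xss))
               ≡ sum (map (f ∘ (true ∷_)) xss) + sum (map (f ∘ (false ∷_)) xss)
  go []         = refl
  go (xs ∷ xss) = trans (cong (λ r → f (true ∷ xs) + (f (false ∷ xs) + r)) (go xss))
                        (shuffle (f (true ∷ xs)) (f (false ∷ xs)) _ _)
    where
    shuffle : ∀ a b c d → a + (b + (c + d)) ≡ (a + c) + (b + d)
    shuffle = solve-∀

∑seq-suc-rise : ∀ n f → (∀ xs → f (false ∷ xs) ≡ 0) → ∑seq (suc n) f ≡ ∑seq n (f ∘ (true ∷_))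
∑seq-suc-rise n f fall≡0 = begin
  ∑seq (suc n) f                                    ≡⟨ ∑seq-suc n f ⟩
  ∑seq n (f ∘ (true ∷_)) + ∑seq n (f ∘ (false ∷_))  ≡⟨ cong (_+_ _) (sum-map-0 (allSeqs n) _ fall≡0) ⟩
  ∑seq n (f ∘ (true ∷_)) + 0                        ≡⟨ +-identityʳ _ ⟩
  ∑seq n (f ∘ (true ∷_))                            ∎

∑seq-cong : ∀ n {f g : List Step → ℕ} → (∀ xs → length xs ≡ n → f xs ≡ g xs) → ∑seq n f ≡ ∑seq n g
∑seq-cong zero    f≗g = cong (_+ 0) (f≗g [] refl)
∑seq-cong (suc n) {f} {g} f≗g = begin
  ∑seq (suc n) f                                       ≡⟨ ∑seq-suc n f ⟩
  ∑seq n (f ∘ (true ∷_)) + ∑seq n (f ∘ (false ∷_))     ≡⟨ cong₂ _+_ (∑seq-cong n (λ xs e → f≗g (true ∷ xs) (cong suc e)))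
                                                                    (∑seq-cong n (λ xs e → f≗g (false ∷ xs) (cong suc e))) ⟩
  ∑seq n (g ∘ (true ∷_)) + ∑seq n (g ∘ (false ∷_))     ≡⟨ ∑seq-suc n g ⟨
  ∑seq (suc n) g                                       ∎

∑seq-++ : ∀ a b f → ∑seq (a + b) f ≡ ∑seq a (λ A → ∑seq b (λ B → f (A ++ B)))
∑seq-++ zero    b f = sym (+-identityʳ _)
∑seq-++ (suc a) b f = begin
  ∑seq (suc (a + b)) f
    ≡⟨ ∑seq-suc (a + b) f ⟩
  ∑seq (a + b) (f ∘ (true ∷_)) + ∑seq (a + b) (f ∘ (false ∷_))
    ≡⟨ cong₂ _+_ (∑seq-++ a b _) (∑seq-++ a b _) ⟩
  ∑seq a (λ A → ∑seq b (λ B → f (true ∷ A ++ B))) + ∑seq a (λ A → ∑seq b (λ B → f (false ∷ A ++ B)))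
    ≡⟨ ∑seq-suc a _ ⟨
  ∑seq (suc a) (λ A → ∑seq b (λ B → f (A ++ B)))
    ∎

+-suc-twice : ∀ a f → a + suc f + suc f ≡ suc (suc (a + f + f))
+-suc-twice = solve-∀

m+0+0≡m : ∀ m → m + 0 + 0 ≡ m
m+0+0≡m m = trans (+-identityʳ (m + 0)) (+-identityʳ m)

heightAfter : ℕ → List Step → Maybe ℕ
heightAfter h       []           = just h
heightAfter h       (true  ∷ xs) = heightAfter (suc h) xs
heightAfter zero    (false ∷ xs) = nothing
heightAfter (suc h) (false ∷ xs) = heightAfter h xs

dyckFrom-++ : ∀ h A R → dyckFrom h (A ++ R) ≡ maybe′ (λ h′ → dyckFrom h′ R) false (heightAfter h A)
dyckFrom-++ h       []          R = refl
dyckFrom-++ h       (true  ∷ A) R = dyckFrom-++ (suc h) A R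
dyckFrom-++ zero    (false ∷ A) R = refl
dyckFrom-++ (suc h) (false ∷ A) R = dyckFrom-++ h A R

heightAfter-falls : ∀ h W {h′} → heightAfter h W ≡ just h′ → h′ + falls W + falls W ≡ h + length W
heightAfter-falls h       []          refl = +-identityʳ (h + 0)
heightAfter-falls h       (true  ∷ W) e    = trans (heightAfter-falls (suc h) W e) (sym (+-suc h (length W)))
heightAfter-falls (suc h) (false ∷ W) {h′} e = begin
  h′ + suc (falls W) + suc (falls W)  ≡⟨ +-suc-twice h′ (falls W) ⟩
  suc (suc (h′ + falls W + falls W))  ≡⟨ cong (suc ∘ suc) (heightAfter-falls h W e) ⟩
  suc (suc (h + length W))            ≡⟨ cong suc (+-suc h (length W)) ⟨
  suc h + suc (length W)              ∎

walks : ℕ → ℕ → ℕ → ℕ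
walks zero    a       b = δ a b
walks (suc n) zero    b = walks n 1 b
walks (suc n) (suc a) b = walks n (suc (suc a)) b + walks n a b

walksWithFalls : ℕ → ℕ → ℕ → ℕ
walksWithFalls zero    h       zero    = 1
walksWithFalls zero    h       (suc f) = 0
walksWithFalls (suc n) zero    f       = walksWithFalls n 1 f
walksWithFalls (suc n) (suc h) zero    = walksWithFalls n (suc (suc h)) zero
walksWithFalls (suc n) (suc h) (suc f) = walksWithFalls n (suc (suc h)) (suc f) + walksWithFalls n h f

∑seq-dyckFrom : ∀ n h → ∑seq n (λ B → toℕ (dyckFrom h B)) ≡ walks n h 0
∑seq-dyckFrom zero    zero    = refl
∑seq-dyckFrom zero    (suc h) = refl
∑seq-dyckFrom (suc n) zero    = trans (∑seq-suc-rise n _ (λ _ → refl)) (∑seq-dyckFrom n 1)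
∑seq-dyckFrom (suc n) (suc h) = trans (∑seq-suc n _) (cong₂ _+_ (∑seq-dyckFrom n (suc (suc h))) (∑seq-dyckFrom n h))

∑seq-continuations : ∀ n e → ∑seq n (λ B → toℕ (maybe′ (λ h → dyckFrom h B) false e)) ≡ maybe′ (λ h → walks n h 0) 0 e
∑seq-continuations n nothing  = sum-map-0 (allSeqs n) _ (λ _ → refl)
∑seq-continuations n (just h) = ∑seq-dyckFrom n h

∑seq-falls : ∀ n h f → ∑seq n (λ W → δ (falls W) f * toℕ (is-just (heightAfter h W))) ≡ walksWithFalls n h f
∑seq-falls zero    h       zero    = refl
∑seq-falls zero    h       (suc f) = refl
∑seq-falls (suc n) zero    f       =
  trans (∑seq-suc-rise n _ (λ W → *-zeroʳ (δ (suc (falls W)) f))) (∑seq-falls n 1 f)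
∑seq-falls (suc n) (suc h) zero    =
  trans (∑seq-suc-rise n _ (λ _ → refl)) (∑seq-falls n (suc (suc h)) 0)
∑seq-falls (suc n) (suc h) (suc f) =
  trans (∑seq-suc n _) (cong₂ _+_ (∑seq-falls n (suc (suc h)) (suc f)) (∑seq-falls n h f))

∑seq-heightAfter : ∀ n h M (Φ : Maybe ℕ → ℕ) → h + n < M → Φ nothing ≡ 0 →
  ∑seq n (λ A → Φ (heightAfter h A)) ≡ ∑[ h′ < M ] walks n h h′ * Φ (just h′)
∑seq-heightAfter zero    h       M Φ h+0<M Φ∅≡0 =
  trans (+-identityʳ _) (sym (∑-δ M h (Φ ∘ just) (subst (_< M) (+-identityʳ h) h+0<M)))
∑seq-heightAfter (suc n) zero    M Φ 1+n<M Φ∅≡0 =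
  trans (∑seq-suc-rise n _ (λ _ → Φ∅≡0)) (∑seq-heightAfter n 1 M Φ 1+n<M Φ∅≡0)
∑seq-heightAfter (suc n) (suc h) M Φ h+n<M Φ∅≡0 = begin
  ∑seq (suc n) (λ A → Φ (heightAfter (suc h) A))
    ≡⟨ ∑seq-suc n _ ⟩
  ∑seq n (λ A → Φ (heightAfter (suc (suc h)) A)) + ∑seq n (λ A → Φ (heightAfter h A))
    ≡⟨ cong₂ _+_ (∑seq-heightAfter n (suc (suc h)) M Φ (≤-trans (≤-reflexive (cong (suc ∘ suc) (sym (+-suc h n)))) h+n<M) Φ∅≡0)
                 (∑seq-heightAfter n h M Φ (≤-trans (s≤s (+-monoʳ-≤ h (n≤1+n n))) (≤-trans (n≤1+n _) h+n<M)) Φ∅≡0) ⟩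
  ∑[ h′ < M ] walks n (suc (suc h)) h′ * Φ (just h′) + ∑[ h′ < M ] walks n h h′ * Φ (just h′)
    ≡⟨ ∑-+ M _ _ ⟨
  ∑[ h′ < M ] (walks n (suc (suc h)) h′ * Φ (just h′) + walks n h h′ * Φ (just h′))
    ≡⟨ ∑-cong M (λ h′ _ → *-distribʳ-+ (Φ (just h′)) (walks n (suc (suc h)) h′) (walks n h h′)) ⟨
  ∑[ h′ < M ] walks (suc n) (suc h) h′ * Φ (just h′)
    ∎

δ-falls-heightAfter : ∀ h W {l s} (g : ℕ → ℕ) → length W ≡ s + (l + l) →
  maybe′ g 0 (heightAfter h W) * δ (falls W) l ≡ (δ (falls W) l * toℕ (is-just (heightAfter h W))) * g (h + s)
δ-falls-heightAfter h W {l} {s} g |W| with heightAfter h W in e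
... | nothing = sym (cong (_* g (h + s)) (*-zeroʳ (δ (falls W) l)))
... | just h′ = begin
  g h′ * δ (falls W) l        ≡⟨ *-comm (g h′) _ ⟩
  δ (falls W) l * g h′        ≡⟨ δ-*-cong (falls W) l (cong g ∘ h′≡h+s) ⟩
  δ (falls W) l * g (h + s)   ≡⟨ cong (_* g (h + s)) (*-identityʳ (δ (falls W) l)) ⟨
  δ (falls W) l * 1 * g (h + s) ∎
  where
  h′≡h+s : falls W ≡ l → h′ ≡ h + s
  h′≡h+s falls≡l = +-cancelʳ-≡ (l + l) h′ (h + s) (begin
    h′ + (l + l)            ≡⟨ +-assoc h′ l l ⟨
    h′ + l + l              ≡⟨ cong (λ x → h′ + x + x) falls≡l ⟨
    h′ + falls W + falls W  ≡⟨ heightAfter-falls h W e ⟩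
    h + length W            ≡⟨ cong (_+_ h) |W| ⟩
    h + (s + (l + l))       ≡⟨ +-assoc h s (l + l) ⟨
    h + s + (l + l)         ∎)

binom⊖ : ℕ → ℕ → ℕ → ℕ
binom⊖ n a       zero    = n C a
binom⊖ n zero    (suc b) = 0
binom⊖ n (suc a) (suc b) = binom⊖ n a b

binom⊖-pascal : ∀ n a b → binom⊖ (suc n) a b ≡ binom⊖ n a b + binom⊖ n a (suc b)
binom⊖-pascal n zero    zero    = refl
binom⊖-pascal n (suc a) zero    = trans (sym (nCk+nC[k+1]≡[n+1]C[k+1] n a)) (+-comm (n C a) (n C suc a))
binom⊖-pascal n zero    (suc b) = refl
binom⊖-pascal n (suc a) (suc b) = binom⊖-pascal n a b

binom⊖-< : ∀ n {a b} → a < b → binom⊖ n a b ≡ 0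
binom⊖-< n {zero}  {suc b} _         = refl
binom⊖-< n {suc a} {suc b} (s<s a<b) = binom⊖-< n a<b

binomℤ-⊖ : ∀ n a b → binomℤ n (a ⊖ b) ≡ + binom⊖ n a b
binomℤ-⊖ n a       zero    = refl
binomℤ-⊖ n zero    (suc b) = refl
binomℤ-⊖ n (suc a) (suc b) = trans (cong (binomℤ n) (ℤP.[1+m]⊖[1+n]≡m⊖n a b)) (binomℤ-⊖ n a b)

-- Reflection principle: the subtracted term counts the walks from h with f falls that go below 0.
walksWithFalls-ballot : ∀ n h f → f + f ≤ h + n → walksWithFalls n h f + binom⊖ n f (suc h) ≡ n C f
walksWithFalls-ballot zero    h       zero    _         = refl
walksWithFalls-ballot zero    h       (suc f) 2+2f≤h+0  =
  binom⊖-< 0 (≤-trans (m≤m+n (suc f) (suc f)) (≤-trans 2+2f≤h+0 (≤-reflexive (+-identityʳ h))))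
walksWithFalls-ballot (suc n) zero    f       2f≤1+n    = begin
  walksWithFalls n 1 f + binom⊖ (suc n) f 1
    ≡⟨ cong (_+_ _) (binom⊖-pascal n f 1) ⟩
  walksWithFalls n 1 f + (binom⊖ n f 1 + binom⊖ n f 2)
    ≡⟨ shuffle (walksWithFalls n 1 f) (binom⊖ n f 1) (binom⊖ n f 2) ⟩
  (walksWithFalls n 1 f + binom⊖ n f 2) + binom⊖ n f 1
    ≡⟨ cong (_+ binom⊖ n f 1) (walksWithFalls-ballot n 1 f 2f≤1+n) ⟩
  n C f + binom⊖ n f 1
    ≡⟨ binom⊖-pascal n f 0 ⟨
  suc n C f
    ∎
  where
  shuffle : ∀ a b c → a + (b + c) ≡ (a + c) + b
  shuffle = solve-∀
walksWithFalls-ballot (suc n) (suc h) zero    _         = walksWithFalls-ballot n (suc (suc h)) zero z≤n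
walksWithFalls-ballot (suc n) (suc h) (suc f) 2+2f≤2+h+n = begin
  (walksWithFalls n (suc (suc h)) (suc f) + walksWithFalls n h f) + binom⊖ (suc n) f (suc h)
    ≡⟨ cong (_+_ _) (binom⊖-pascal n f (suc h)) ⟩
  (walksWithFalls n (suc (suc h)) (suc f) + walksWithFalls n h f) + (binom⊖ n f (suc h) + binom⊖ n (suc f) (suc (suc (suc h))))
    ≡⟨ shuffle (walksWithFalls n (suc (suc h)) (suc f)) (walksWithFalls n h f) _ _ ⟩
  (walksWithFalls n h f + binom⊖ n f (suc h)) + (walksWithFalls n (suc (suc h)) (suc f) + binom⊖ n (suc f) (suc (suc (suc h))))
    ≡⟨ cong₂ _+_ (walksWithFalls-ballot n h f 2f≤h+n) (walksWithFalls-ballot n (suc (suc h)) (suc f) 2+2f≤2+h+n′) ⟩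
  n C f + n C suc f
    ≡⟨ nCk+nC[k+1]≡[n+1]C[k+1] n f ⟩
  suc n C suc f
    ∎
  where
  shuffle : ∀ a b c d → (a + b) + (c + d) ≡ (b + c) + (a + d)
  shuffle = solve-∀
  2+2f≤2+h+n′ : suc f + suc f ≤ suc (suc h) + n
  2+2f≤2+h+n′ = subst (suc f + suc f ≤_) (+-suc (suc h) n) 2+2f≤2+h+n
  2f≤h+n : f + f ≤ h + n
  2f≤h+n = ≤-pred (subst₂ _≤_ (+-suc f f) (+-suc h n) (≤-pred 2+2f≤2+h+n))

walks-vanish : ∀ n a b → a + n < b → walks n a b ≡ 0
walks-vanish zero    a       b a+0<b = δ-≢ a b (λ a≡b → <-irrefl (trans (+-identityʳ a) a≡b) a+0<b)
walks-vanish (suc n) zero    b 1+n<b = walks-vanish n 1 b 1+n<b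
walks-vanish (suc n) (suc a) b a+n<b = cong₂ _+_
  (walks-vanish n (suc (suc a)) b (≤-trans (≤-reflexive (cong (suc ∘ suc) (sym (+-suc a n)))) a+n<b))
  (walks-vanish n a b (≤-trans (s≤s (+-monoʳ-≤ a (n≤1+n n))) (≤-trans (n≤1+n _) a+n<b)))

walks≡walksWithFalls : ∀ n a b f → b + f + f ≡ a + n → walks n a b ≡ walksWithFalls n a f
walks≡walksWithFalls zero    a       b zero    e = trans (cong (δ a) b≡a) (δ-refl a)
  where
  b≡a : b ≡ a
  b≡a = trans (sym (m+0+0≡m b)) (trans e (+-identityʳ a))
walks≡walksWithFalls zero    a       b (suc f) e = δ-≢ a b (>⇒≢ b<a)
  where
  b<a : b < a
  b<a = ≤-trans (m<m+n b z<s) (≤-trans (m≤m+n (b + suc f) (suc f)) (≤-reflexive (trans e (+-identityʳ a))))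
walks≡walksWithFalls (suc n) zero    b f       e = walks≡walksWithFalls n 1 b f e
walks≡walksWithFalls (suc n) (suc a) b zero    e = begin
  walks n (suc (suc a)) b + walks n a b
    ≡⟨ cong₂ _+_ (walks≡walksWithFalls n (suc (suc a)) b 0 (trans e (+-suc (suc a) n))) (walks-vanish n a b a+n<b) ⟩
  walksWithFalls n (suc (suc a)) 0 + 0
    ≡⟨ +-identityʳ _ ⟩
  walksWithFalls n (suc (suc a)) 0
    ∎
  where
  a+n<b : a + n < b
  a+n<b = ≤-trans (n≤1+n _) (≤-reflexive (trans (cong suc (sym (+-suc a n))) (trans (sym e) (m+0+0≡m b))))
walks≡walksWithFalls (suc n) (suc a) b (suc f) e = cong₂ _+_
  (walks≡walksWithFalls n (suc (suc a)) b (suc f) (trans e (+-suc (suc a) n)))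
  (walks≡walksWithFalls n a b f (suc-injective (suc-injective (trans (sym (+-suc-twice b f)) (trans e (cong suc (+-suc a n)))))))

walksThenRise : ℕ → ℕ → ℕ → ℕ
walksThenRise n a zero    = 0
walksThenRise n a (suc b) = walks n a b

walks-suc-last : ∀ n a b → walks (suc n) a b ≡ walks n a (suc b) + walksThenRise n a b
walks-suc-last zero    zero    zero    = refl
walks-suc-last zero    zero    (suc b) = refl
walks-suc-last zero    (suc a) zero    = +-comm (δ (suc (suc a)) 0) (δ a 0)
walks-suc-last zero    (suc a) (suc b) = +-comm (δ (suc a) b) (δ a (suc b))
walks-suc-last (suc n) zero    zero    = walks-suc-last n 1 zero
walks-suc-last (suc n) zero    (suc b) = walks-suc-last n 1 (suc b)
walks-suc-last (suc n) (suc a) b       = begin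
  walks (suc n) (suc (suc a)) b + walks (suc n) a b
    ≡⟨ cong₂ _+_ (walks-suc-last n (suc (suc a)) b) (walks-suc-last n a b) ⟩
  (walks n (suc (suc a)) (suc b) + walksThenRise n (suc (suc a)) b) + (walks n a (suc b) + walksThenRise n a b)
    ≡⟨ interchange (walks n (suc (suc a)) (suc b)) _ _ _ ⟩
  walks (suc n) (suc a) (suc b) + (walksThenRise n (suc (suc a)) b + walksThenRise n a b)
    ≡⟨ cong (_+_ _) (thenRise b) ⟩
  walks (suc n) (suc a) (suc b) + walksThenRise (suc n) (suc a) b
    ∎
  where
  thenRise : ∀ b → walksThenRise n (suc (suc a)) b + walksThenRise n a b ≡ walksThenRise (suc n) (suc a) b
  thenRise zero    = refl
  thenRise (suc b) = refl

-- Split at the last visit to height h: the following step rises, and the rest is a walk from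
-- h + 1 to h + 1 + g staying above h, equinumerous (shift, then reverse) with walks from g to 0.
walks-lastVisit : ∀ n h g → walks (suc n) 0 (h + suc g) ≡ ∑[ i < suc n ] walks i 0 h * walks (n ∸ i) g 0
walks-lastVisit zero    zero    zero    = refl
walks-lastVisit zero    zero    (suc g) = refl
walks-lastVisit zero    (suc h) g       = cong (δ 0) (+-suc h g)
walks-lastVisit (suc n) h       g       = begin
  walks (suc (suc n)) 0 (h + suc g)
    ≡⟨ walks-suc-last (suc n) 0 (h + suc g) ⟩
  walks (suc n) 0 (suc (h + suc g)) + walksThenRise (suc n) 0 (h + suc g)
    ≡⟨ cong₂ _+_ (cong (walks (suc n) 0) (+-suc h (suc g))) (cong (walksThenRise (suc n) 0) (sym (+-suc h g))) ⟨
  walks (suc n) 0 (h + suc (suc g)) + walks (suc n) 0 (h + g)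
    ≡⟨ cong₂ _+_ (walks-lastVisit n h (suc g)) (walks-oneLower g) ⟩
  ∑[ i < suc n ] walks i 0 h * walks (n ∸ i) (suc g) 0 + oneLower g
    ≡⟨ firstStep g ⟩
  ∑[ i < suc n ] walks i 0 h * walks (suc (n ∸ i)) g 0 + walks (suc n) 0 h * δ g 0
    ≡⟨ cong₂ _+_ (∑-cong (suc n) (λ i i<1+n → cong (λ j → walks i 0 h * walks j g 0) (+-∸-assoc 1 (m<1+n⇒m≤n i<1+n))))
                 (cong (λ j → walks (suc n) 0 h * walks j g 0) (n∸n≡0 n)) ⟨
  ∑[ i < suc (suc n) ] walks i 0 h * walks (suc n ∸ i) g 0
    ∎
  where
  oneLower : ℕ → ℕ
  oneLower zero    = walks (suc n) 0 h
  oneLower (suc g) = ∑[ i < suc n ] walks i 0 h * walks (n ∸ i) g 0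
  walks-oneLower : ∀ g → walks (suc n) 0 (h + g) ≡ oneLower g
  walks-oneLower zero    = cong (walks (suc n) 0) (+-identityʳ h)
  walks-oneLower (suc g) = walks-lastVisit n h g
  firstStep : ∀ g → ∑[ i < suc n ] walks i 0 h * walks (n ∸ i) (suc g) 0 + oneLower g
                  ≡ ∑[ i < suc n ] walks i 0 h * walks (suc (n ∸ i)) g 0 + walks (suc n) 0 h * δ g 0
  firstStep zero    = cong (_+_ (∑[ i < suc n ] walks i 0 h * walks (n ∸ i) 1 0)) (sym (*-identityʳ (walks (suc n) 0 h)))
  firstStep (suc g) = begin
    ∑[ i < suc n ] walks i 0 h * walks (n ∸ i) (suc (suc g)) 0 + ∑[ i < suc n ] walks i 0 h * walks (n ∸ i) g 0
      ≡⟨ ∑-+ (suc n) _ _ ⟨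
    ∑[ i < suc n ] (walks i 0 h * walks (n ∸ i) (suc (suc g)) 0 + walks i 0 h * walks (n ∸ i) g 0)
      ≡⟨ ∑-cong (suc n) (λ i _ → *-distribˡ-+ (walks i 0 h) _ _) ⟨
    ∑[ i < suc n ] walks i 0 h * walks (suc (n ∸ i)) (suc g) 0
      ≡⟨ +-identityʳ _ ⟨
    ∑[ i < suc n ] walks i 0 h * walks (suc (n ∸ i)) (suc g) 0 + 0
      ≡⟨ cong (_+_ _) (*-zeroʳ (walks (suc n) 0 h)) ⟨
    ∑[ i < suc n ] walks i 0 h * walks (suc (n ∸ i)) (suc g) 0 + walks (suc n) 0 h * 0
      ∎

<∸⇒+≤ : ∀ {a m d} → d < suc a ∸ m → m + d ≤ a
<∸⇒+≤ {a} {m} {d} d<1+a∸m =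
  ≤-pred (subst (_≤ suc a) (trans (+-comm (suc d) m) (+-suc m d)) (m≤o∸n⇒m+n≤o (suc d) m≤1+a d<1+a∸m))
  where
  m≤1+a : m ≤ suc a
  m≤1+a = <⇒≤ (m∸n≢0⇒n<m (m<n⇒n≢0 d<1+a∸m))

⊖-minus : ∀ a b c → (a ⊖ b) ℤ.- + c ≡ a ⊖ (b + c)
⊖-minus a b zero    = trans (ℤP.+-identityʳ (a ⊖ b)) (cong (_⊖_ a) (sym (+-identityʳ b)))
⊖-minus a b (suc c) = trans (ℤP.distribˡ-⊖-+-neg c a b) (cong (_⊖_ a) (sym (+-suc b c)))

pos-minus-pos : ∀ a b → + (a + b) ℤ.- + b ≡ + a
pos-minus-pos a b = trans (ℤP.[+m]-[+n]≡m⊖n (a + b) b) (trans (ℤP.⊖-≥ (m≤n+m b a)) (cong +_ (m+n∸n≡m a b)))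

pos-∑ : ∀ n (f : ℕ → ℕ) → + ∑ n f ≡ sumℤ n (λ i → + f i)
pos-∑ zero    f = refl
pos-∑ (suc n) f = cong (ℤ._+ + f n) (pos-∑ n f)

sumℤ-cong : ∀ n {f g : ℕ → ℤ} → (∀ i → i < n → f i ≡ g i) → sumℤ n f ≡ sumℤ n g
sumℤ-cong zero    f≗g = refl
sumℤ-cong (suc n) f≗g = cong₂ ℤ._+_ (sumℤ-cong n (λ i i<n → f≗g i (m<n⇒m<1+n i<n))) (f≗g n ≤-refl)

walksWithFalls-ballotℤ : ∀ n h f → f + f ≤ h + n →
  + walksWithFalls n h f ≡ binomℤ n (+ f) ℤ.- binomℤ n (f ⊖ suc h)
walksWithFalls-ballotℤ n h f 2f≤h+n = begin
  + walksWithFalls n h f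
    ≡⟨ pos-minus-pos (walksWithFalls n h f) (binom⊖ n f (suc h)) ⟨
  + (walksWithFalls n h f + binom⊖ n f (suc h)) ℤ.- + binom⊖ n f (suc h)
    ≡⟨ cong₂ ℤ._-_ (cong +_ (walksWithFalls-ballot n h f 2f≤h+n)) (sym (binomℤ-⊖ n f (suc h))) ⟩
  binomℤ n (+ f) ℤ.- binomℤ n (f ⊖ suc h)
    ∎

take-drop-++ : ∀ {X : Set} (A W B : List X) → take (length W) (drop (length A) (A ++ W ++ B)) ≡ W
take-drop-++ (x ∷ A) W       B = take-drop-++ A W B
take-drop-++ []      []      B = refl
take-drop-++ []      (w ∷ W) B = cong (w ∷_) (take-drop-++ [] W B)

if-≟true : ∀ b x → (if does (b Bool.≟ true) then x else 0) ≡ toℕ b * x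
if-≟true true  x = sym (+-identityʳ x)
if-≟true false x = refl

dyckWindow : ℕ → ℕ → ℕ → List Step → ℕ
dyckWindow m l i D = toℕ (isDyck D) * δ (falls (take m (drop i D))) l

SD≡∑ : ∀ D m l → SD D m l ≡ ∑[ i < suc (length D) ∸ m ] δ (falls (take m (drop i D))) l
SD≡∑ D m l = trans (length-filter _ (upTo (suc (length D) ∸ m))) (sum-map-upTo (suc (length D) ∸ m) _)

S≡∑windows : ∀ k m l →
  S k m l ≡ ∑[ i < suc (k + k) ∸ m ] ∑seq (k + k) (dyckWindow m l i)
S≡∑windows k m l = begin
  S k m l
    ≡⟨ sum-map-filter _ (allSeqs (k + k)) (λ D → SD D m l) ⟩
  ∑seq (k + k) (λ D → if does (isDyck D Bool.≟ true) then SD D m l else 0)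
    ≡⟨ ∑seq-cong (k + k) (λ D |D| → trans (if-≟true (isDyck D) (SD D m l)) (cong (_*_ (toℕ (isDyck D))) (SD≡∑′ D |D|))) ⟩
  ∑seq (k + k) (λ D → toℕ (isDyck D) * (∑[ i < N ] δ (falls (take m (drop i D))) l))
    ≡⟨ ∑seq-cong (k + k) (λ D _ → ∑-*ˡ N (toℕ (isDyck D)) _) ⟨
  ∑seq (k + k) (λ D → ∑[ i < N ] toℕ (isDyck D) * δ (falls (take m (drop i D))) l)
    ≡⟨ sum-map-∑ (allSeqs (k + k)) N _ ⟩
  ∑[ i < N ] ∑seq (k + k) (dyckWindow m l i)
    ∎
  where
  N : ℕ
  N = suc (k + k) ∸ m
  SD≡∑′ : ∀ D → length D ≡ k + k → SD D m l ≡ ∑[ i < N ] δ (falls (take m (drop i D))) l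
  SD≡∑′ D |D| = trans (SD≡∑ D m l) (cong (λ L → ∑ (suc L ∸ m) (λ i → δ (falls (take m (drop i D))) l)) |D|)

∑seq-window : ∀ i j {m l s} M → s + (l + l) ≡ m → i < M →
  ∑seq (i + (m + j)) (dyckWindow m l i) ≡ ∑[ h < M ] walks i 0 h * (walksWithFalls m h l * walks j (h + s) 0)
∑seq-window i j {m} {l} {s} M s+2l≡m i<M = begin
  ∑seq (i + (m + j)) (dyckWindow m l i)
    ≡⟨ ∑seq-++ i (m + j) (dyckWindow m l i) ⟩
  ∑seq i (λ A → ∑seq (m + j) (λ R → dyckWindow m l i (A ++ R)))
    ≡⟨ ∑seq-cong i (λ A |A| → trans (∑seq-++ m j _) (∑seq-cong m (λ W |W| → ∑seq-cong j (λ B _ → split A W B |A| |W|)))) ⟩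
  ∑seq i (λ A → Φ (heightAfter 0 A))
    ≡⟨ ∑seq-heightAfter i 0 M Φ i<M (sum-map-0 (allSeqs m) _ (λ _ → sum-map-0 (allSeqs j) _ (λ _ → refl))) ⟩
  ∑[ h < M ] walks i 0 h * Φ (just h)
    ≡⟨ ∑-cong M (λ h _ → cong (_*_ (walks i 0 h)) (Φ-just h)) ⟩
  ∑[ h < M ] walks i 0 h * (walksWithFalls m h l * walks j (h + s) 0)
    ∎
  where
  Φ : Maybe ℕ → ℕ
  Φ e = ∑seq m (λ W → ∑seq j (λ B → toℕ (maybe′ (λ h → dyckFrom h (W ++ B)) false e) * δ (falls W) l))

  split : ∀ A W B → length A ≡ i → length W ≡ m →
    dyckWindow m l i (A ++ W ++ B) ≡ toℕ (maybe′ (λ h → dyckFrom h (W ++ B)) false (heightAfter 0 A)) * δ (falls W) l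
  split A W B |A| |W| = cong₂ _*_ (cong toℕ (dyckFrom-++ 0 A (W ++ B))) (cong (λ V → δ (falls V) l) window)
    where
    window : take m (drop i (A ++ W ++ B)) ≡ W
    window = trans (cong₂ (λ a w → take w (drop a (A ++ W ++ B))) (sym |A|) (sym |W|)) (take-drop-++ A W B)

  weight : ∀ h W → length W ≡ m →
    ∑seq j (λ B → toℕ (dyckFrom h (W ++ B)) * δ (falls W) l)
      ≡ δ (falls W) l * toℕ (is-just (heightAfter h W)) * walks j (h + s) 0
  weight h W |W| = begin
    ∑seq j (λ B → toℕ (dyckFrom h (W ++ B)) * δ (falls W) l)
      ≡⟨ ∑seq-cong j (λ B _ → cong (λ b → toℕ b * δ (falls W) l) (dyckFrom-++ h W B)) ⟩
    ∑seq j (λ B → toℕ (maybe′ (λ h′ → dyckFrom h′ B) false (heightAfter h W)) * δ (falls W) l)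
      ≡⟨ sum-map-*ʳ (allSeqs j) _ _ ⟩
    ∑seq j (λ B → toℕ (maybe′ (λ h′ → dyckFrom h′ B) false (heightAfter h W))) * δ (falls W) l
      ≡⟨ cong (_* δ (falls W) l) (∑seq-continuations j (heightAfter h W)) ⟩
    maybe′ (λ h′ → walks j h′ 0) 0 (heightAfter h W) * δ (falls W) l
      ≡⟨ δ-falls-heightAfter h W (λ h′ → walks j h′ 0) (trans |W| (sym s+2l≡m)) ⟩
    δ (falls W) l * toℕ (is-just (heightAfter h W)) * walks j (h + s) 0
      ∎

  Φ-just : ∀ h → Φ (just h) ≡ walksWithFalls m h l * walks j (h + s) 0
  Φ-just h = begin
    Φ (just h)
      ≡⟨ ∑seq-cong m (weight h) ⟩
    ∑seq m (λ W → δ (falls W) l * toℕ (is-just (heightAfter h W)) * walks j (h + s) 0)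
      ≡⟨ sum-map-*ʳ (allSeqs m) _ _ ⟩
    ∑seq m (λ W → δ (falls W) l * toℕ (is-just (heightAfter h W))) * walks j (h + s) 0
      ≡⟨ cong (_* walks j (h + s) 0) (∑seq-falls m h l) ⟩
    walksWithFalls m h l * walks j (h + s) 0
      ∎

module WindowCount (k m l n s : ℕ) (n+m≡k+k : n + m ≡ k + k) (s+2l≡m : s + (l + l) ≡ m) where

  1+2k∸m≡1+n : suc (k + k) ∸ m ≡ suc n
  1+2k∸m≡1+n = trans (cong (λ x → suc x ∸ m) (sym n+m≡k+k)) (m+n∸n≡m (suc n) m)

  S≡∑walks : S k m l ≡ ∑[ h < suc n ] walksWithFalls m h l * walks (suc n) 0 (h + suc (h + s))
  S≡∑walks = begin
    S k m l
      ≡⟨ S≡∑windows k m l ⟩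
    ∑[ i < suc (k + k) ∸ m ] ∑seq (k + k) (dyckWindow m l i)
      ≡⟨ cong (λ N → ∑[ i < N ] ∑seq (k + k) (dyckWindow m l i)) 1+2k∸m≡1+n ⟩
    ∑[ i < suc n ] ∑seq (k + k) (dyckWindow m l i)
      ≡⟨ ∑-cong (suc n) (λ i i<1+n → trans (cong (λ L → ∑seq L (dyckWindow m l i)) (2k≡i+m+j (m<1+n⇒m≤n i<1+n)))
                                           (∑seq-window i (n ∸ i) (suc n) s+2l≡m i<1+n)) ⟩
    ∑[ i < suc n ] ∑[ h < suc n ] walks i 0 h * (walksWithFalls m h l * walks (n ∸ i) (h + s) 0)
      ≡⟨ ∑-comm (suc n) (suc n) _ ⟩
    ∑[ h < suc n ] ∑[ i < suc n ] walks i 0 h * (walksWithFalls m h l * walks (n ∸ i) (h + s) 0)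
      ≡⟨ ∑-cong (suc n) (λ h _ → lastVisits h) ⟩
    ∑[ h < suc n ] walksWithFalls m h l * walks (suc n) 0 (h + suc (h + s))
      ∎
    where
    2k≡i+m+j : ∀ {i} → i ≤ n → k + k ≡ i + (m + (n ∸ i))
    2k≡i+m+j {i} i≤n = begin
      k + k               ≡⟨ n+m≡k+k ⟨
      n + m               ≡⟨ cong (_+ m) (m+[n∸m]≡n i≤n) ⟨
      i + (n ∸ i) + m     ≡⟨ +-assoc i (n ∸ i) m ⟩
      i + (n ∸ i + m)     ≡⟨ cong (_+_ i) (+-comm (n ∸ i) m) ⟩
      i + (m + (n ∸ i))   ∎

    lastVisits : ∀ h → ∑[ i < suc n ] walks i 0 h * (walksWithFalls m h l * walks (n ∸ i) (h + s) 0)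
                     ≡ walksWithFalls m h l * walks (suc n) 0 (h + suc (h + s))
    lastVisits h = begin
      ∑[ i < suc n ] walks i 0 h * (walksWithFalls m h l * walks (n ∸ i) (h + s) 0)
        ≡⟨ ∑-cong (suc n) (λ i _ → m*[n*o]≡n*[m*o] (walks i 0 h) (walksWithFalls m h l) (walks (n ∸ i) (h + s) 0)) ⟩
      ∑[ i < suc n ] walksWithFalls m h l * (walks i 0 h * walks (n ∸ i) (h + s) 0)
        ≡⟨ ∑-*ˡ (suc n) (walksWithFalls m h l) _ ⟩
      walksWithFalls m h l * (∑[ i < suc n ] walks i 0 h * walks (n ∸ i) (h + s) 0)
        ≡⟨ cong (_*_ (walksWithFalls m h l)) (walks-lastVisit n h (h + s)) ⟨
      walksWithFalls m h l * walks (suc n) 0 (h + suc (h + s))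
        ∎

  range≤ : suc (k + l) ∸ m ≤ suc n
  range≤ = ≤-trans (∸-monoˡ-≤ m (s≤s (+-monoʳ-≤ k l≤k))) (≤-reflexive 1+2k∸m≡1+n)
    where
    l≤k : l ≤ k
    l≤k = ≮⇒≥ (λ k<l → <⇒≱ (+-mono-< k<l k<l) (≤-trans (subst (_≤_ (l + l)) s+2l≡m (m≤n+m (l + l) s))
                                                          (subst (_≤_ m) n+m≡k+k (m≤n+m m n))))

  walks-beyond : ∀ h → suc (k + l) ∸ m ≤ h → walks (suc n) 0 (h + suc (h + s)) ≡ 0
  walks-beyond h M≤h = walks-vanish (suc n) 0 _
    (≤-trans 2+n≤2h+s (≤-trans (n≤1+n _) (≤-reflexive (trans (cong suc (+-assoc h h s)) (sym (+-suc h (h + s)))))))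
    where
    1+k+l≤m+h : suc (k + l) ≤ m + h
    1+k+l≤m+h = ≤-trans (m≤n+m∸n (suc (k + l)) m) (+-monoʳ-≤ m M≤h)

    lower : suc (suc n) + (m + (l + l)) ≡ suc (k + l) + suc (k + l)
    lower = begin
      suc (suc n) + (m + (l + l))   ≡⟨ +-assoc (suc (suc n)) m (l + l) ⟨
      suc (suc (n + m)) + (l + l)   ≡⟨ cong (λ x → suc (suc x) + (l + l)) n+m≡k+k ⟩
      suc (suc (k + k)) + (l + l)   ≡⟨ regroup k l ⟩
      suc (k + l) + suc (k + l)     ∎
      where
      regroup : ∀ k l → suc (suc (k + k)) + (l + l) ≡ suc (k + l) + suc (k + l)
      regroup = solve-∀

    upper : (m + h) + (m + h) ≡ h + h + s + (m + (l + l))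
    upper = begin
      (m + h) + (m + h)              ≡⟨ regroup m h ⟩
      h + h + m + m                  ≡⟨ cong (λ x → h + h + x + m) s+2l≡m ⟨
      h + h + (s + (l + l)) + m      ≡⟨ regroup′ h s l m ⟩
      h + h + s + (m + (l + l))      ∎
      where
      regroup : ∀ m h → (m + h) + (m + h) ≡ h + h + m + m
      regroup = solve-∀
      regroup′ : ∀ h s l m → h + h + (s + (l + l)) + m ≡ h + h + s + (m + (l + l))
      regroup′ = solve-∀

    2+n≤2h+s : suc (suc n) ≤ h + h + s
    2+n≤2h+s = +-cancelʳ-≤ (m + (l + l)) _ _
      (≤-trans (≤-reflexive lower) (≤-trans (+-mono-≤ 1+k+l≤m+h 1+k+l≤m+h) (≤-reflexive upper)))

  fallsBalance : ∀ {d f} → m + d + f ≡ k + l → d + suc (d + s) + f + f ≡ suc n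
  fallsBalance {d} {f} m+d+f≡k+l = +-cancelʳ-≡ (m + (l + l)) _ _ (begin
    d + suc (d + s) + f + f + (m + (l + l))   ≡⟨ regroup d s f m l ⟩
    suc (s + (l + l) + d + f + (m + d + f))   ≡⟨ cong (λ x → suc (x + d + f + (m + d + f))) s+2l≡m ⟩
    suc (m + d + f + (m + d + f))             ≡⟨ cong (λ x → suc (x + x)) m+d+f≡k+l ⟩
    suc (k + l + (k + l))                     ≡⟨ regroup′ k l ⟩
    suc (k + k) + (l + l)                     ≡⟨ cong (λ x → suc x + (l + l)) n+m≡k+k ⟨
    suc (n + m) + (l + l)                     ≡⟨ +-assoc (suc n) m (l + l) ⟩
    suc n + (m + (l + l))                     ∎)
    where
    regroup : ∀ d s f m l → d + suc (d + s) + f + f + (m + (l + l)) ≡ suc (s + (l + l) + d + f + (m + d + f))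
    regroup = solve-∀
    regroup′ : ∀ k l → suc (k + l + (k + l)) ≡ suc (k + k) + (l + l)
    regroup′ = solve-∀

  rhs-term : ∀ d → d < suc (k + l) ∸ m →
    + (walksWithFalls m d l * walks (suc n) 0 (d + suc (d + s)))
      ≡ (binomℤ m (+ l) ℤ.- binomℤ m (+ l ℤ.- + d ℤ.- + 1))
        ℤ.* (binomℤ (suc n) (+ k ℤ.- + m ℤ.+ + l ℤ.- + d) ℤ.- binomℤ (suc n) (+ k ℤ.- + m ℤ.+ + l ℤ.- + d ℤ.- + 1))
  rhs-term d d<M = trans (ℤP.pos-* (walksWithFalls m d l) (walks (suc n) 0 (d + suc (d + s)))) (cong₂ ℤ._*_ first second)
    where
    f : ℕ
    f = k + l ∸ (m + d)

    m+d+f≡k+l : m + d + f ≡ k + l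
    m+d+f≡k+l = m+[n∸m]≡n (<∸⇒+≤ {k + l} {m} d<M)

    index : + k ℤ.- + m ℤ.+ + l ℤ.- + d ≡ + f
    index = begin
      + k ℤ.- + m ℤ.+ + l ℤ.- + d  ≡⟨ cong (λ z → z ℤ.+ + l ℤ.- + d) (ℤP.[+m]-[+n]≡m⊖n k m) ⟩
      k ⊖ m ℤ.+ + l ℤ.- + d        ≡⟨ cong (ℤ._- + d) (ℤP.distribˡ-⊖-+-pos l k m) ⟩
      (k + l) ⊖ m ℤ.- + d          ≡⟨ ⊖-minus (k + l) m d ⟩
      (k + l) ⊖ (m + d)            ≡⟨ cong (_⊖ (m + d)) m+d+f≡k+l ⟨
      (m + d + f) ⊖ (m + d)        ≡⟨ ℤP.⊖-≥ (m≤m+n (m + d) f) ⟩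
      + (m + d + f ∸ (m + d))      ≡⟨ cong +_ (m+n∸m≡n (m + d) f) ⟩
      + f                          ∎

    first : + walksWithFalls m d l ≡ binomℤ m (+ l) ℤ.- binomℤ m (+ l ℤ.- + d ℤ.- + 1)
    first = begin
      + walksWithFalls m d l
        ≡⟨ walksWithFalls-ballotℤ m d l (≤-trans (subst (_≤_ (l + l)) s+2l≡m (m≤n+m (l + l) s)) (m≤n+m m d)) ⟩
      binomℤ m (+ l) ℤ.- binomℤ m (l ⊖ suc d)
        ≡⟨ cong (λ z → binomℤ m (+ l) ℤ.- binomℤ m z) (trans (⊖-minus l d 1) (cong (_⊖_ l) (+-comm d 1))) ⟨
      binomℤ m (+ l) ℤ.- binomℤ m (l ⊖ d ℤ.- + 1)
        ≡⟨ cong (λ z → binomℤ m (+ l) ℤ.- binomℤ m (z ℤ.- + 1)) (ℤP.[+m]-[+n]≡m⊖n l d) ⟨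
      binomℤ m (+ l) ℤ.- binomℤ m (+ l ℤ.- + d ℤ.- + 1)
        ∎

    second : + walks (suc n) 0 (d + suc (d + s))
           ≡ binomℤ (suc n) (+ k ℤ.- + m ℤ.+ + l ℤ.- + d) ℤ.- binomℤ (suc n) (+ k ℤ.- + m ℤ.+ + l ℤ.- + d ℤ.- + 1)
    second = begin
      + walks (suc n) 0 (d + suc (d + s))
        ≡⟨ cong +_ (walks≡walksWithFalls (suc n) 0 _ f (fallsBalance m+d+f≡k+l)) ⟩
      + walksWithFalls (suc n) 0 f
        ≡⟨ walksWithFalls-ballotℤ (suc n) 0 f 2f≤1+n ⟩
      binomℤ (suc n) (+ f) ℤ.- binomℤ (suc n) (f ⊖ 1)
        ≡⟨ cong₂ (λ x y → binomℤ (suc n) x ℤ.- binomℤ (suc n) y) index (trans (cong (ℤ._- + 1) index) (ℤP.[+m]-[+n]≡m⊖n f 1)) ⟨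
      binomℤ (suc n) (+ k ℤ.- + m ℤ.+ + l ℤ.- + d) ℤ.- binomℤ (suc n) (+ k ℤ.- + m ℤ.+ + l ℤ.- + d ℤ.- + 1)
        ∎
      where
      2f≤1+n : f + f ≤ suc n
      2f≤1+n = ≤-trans (m≤n+m (f + f) (d + suc (d + s)))
                       (≤-reflexive (trans (sym (+-assoc (d + suc (d + s)) f f)) (fallsBalance m+d+f≡k+l)))

theorem1 : (k m l : ℕ) → l + l ≤ m → m ≤ k + k → + (S k m l) ≡ RHS k m l
theorem1 k m l 2l≤m m≤2k = begin
  + S k m l                 ≡⟨ cong +_ S≡∑walks ⟩
  + ∑ (suc n) F             ≡⟨ cong +_ (∑-truncate F range≤ F-vanish) ⟩
  + ∑ M F                   ≡⟨ pos-∑ M F ⟩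
  sumℤ M (λ d → + F d)      ≡⟨ sumℤ-cong M rhs-term ⟩
  RHS k m l                 ∎
  where
  n s M : ℕ
  n = k + k ∸ m
  s = m ∸ (l + l)
  M = suc (k + l) ∸ m

  n+m≡k+k : n + m ≡ k + k
  n+m≡k+k = m∸n+n≡m m≤2k

  s+2l≡m : s + (l + l) ≡ m
  s+2l≡m = m∸n+n≡m 2l≤m

  open WindowCount k m l n s n+m≡k+k s+2l≡m

  F : ℕ → ℕ
  F h = walksWithFalls m h l * walks (suc n) 0 (h + suc (h + s))

  F-vanish : ∀ h → M ≤ h → F h ≡ 0
  F-vanish h M≤h = trans (cong (_*_ (walksWithFalls m h l)) (walks-beyond h M≤h)) (*-zeroʳ (walksWithFalls m h l))
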